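{- Every well-typed term of $\lambda^{\Box\rightarrow\wedge\vee}$ is strongly normalizing with respect to the detour conversions $>_D$.
   Context: $\lambda^{\Box\rightarrow\wedge\vee}$: types $T::=p\mid A\rightarrow B\mid A\times B\mid A+B\mid \Box A$; terms $x\mid \lambda x.t\mid ts\mid \langle t,s\rangle\mid \pi_1 t\mid \pi_2 t\mid \mathsf{in}_1 t\mid \mathsf{in}_2 t\mid \mathsf{C}_{x,y}(t,t_1,t_2)\mid \mathsf{B}_{x_1,\dots,x_n}(t_1,\dots,t_n)\,\mathsf{in}\,s$ ($\mathsf{C}$ binds $x$ in $t_1$, $y$ in $t_2$; $\mathsf{B}$ binds $x_1,\dots,x_n$ in $s$). Typing: standard simply typed rules for $\rightarrow,\times,+$, plus: if $\Gamma_i\vdash t_i:\Box A_i$ and $x_1:A_1,\dots,x_n:A_n,\Delta\vdash s:B$ then $\Gamma_1,\dots,\Gamma_n,\Delta\vdash\mathsf{B}_{x_1,\dots,x_n}(t_1,\dots,t_n)\,\mathsf{in}\,s:\Box B$. Detours $>_D$ (closed under term contexts): $(\lambda x.t)s> t[x:=s]$; $\pi_i\langle t_1,t_2\rangle> t_i$ ($i=1,2$); $\mathsf{C}_{x_1,x_2}(\mathsf{in}_i t,t_1,t_2)> t_i[x_i:=t]$; $\mathsf{B}_{x_1,\dots,x_{i-1},x_i,x_{i+1},\dots,x_n}(t_1,\dots,t_{i-1},(\mathsf{B}_{\vec y}(\vec s)\,\mathsf{in}\,t_i),t_{i+1},\dots,t_n)\,\mathsf{in}\,r > \mathsf{B}_{x_1,\dots,x_{i-1},\vec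 y,x_{i+1},\dots,x_n}(t_1,\dots,t_{i-1},\vec s,t_{i+1},\dots,t_n)\,\mathsf{in}\,r[x_i:=t_i]$; $\mathsf{B}_x t\,\mathsf{in}\,x> t$. -}

module Defs where

open import Data.Nat using (ℕ; zero; suc; _+_; _∸_; _<?_; _≟_)
open import Data.List using (List; []; _∷_; _++_)
open import Data.Vec using (Vec; []; _∷_; toList) renaming (_++_ to _++ᵛ_)
open import Relation.Nullary using (yes; no)
open import Relation.Binary.Core using (Rel)
open import Induction.WellFounded using (Acc)

data Ty : Set where
  atom : ℕ → Ty
  _⇒_  : Ty → Ty → Ty
  _⊗_  : Ty → Ty → Ty
  _⊕_  : Ty → Ty → Ty
  □_   : Ty → Ty

-- Raw terms, de Bruijn indices.
-- lam t           : t under 1 binder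
-- case t t₁ t₂    : C_{x,y}(t,t₁,t₂), t₁ and t₂ each under 1 binder
-- bx ts s         : B_{x_1..x_n}(t_1..t_n) in s, with ts : Vec Tm n and s under
--                   n binders; in s, index j < n is x_{j+1} (the j-th entry of
--                   ts, 0-based), index n + k is the outer variable k.
data Tm : Set where
  var  : ℕ → Tm
  lam  : Tm → Tm
  app  : Tm → Tm → Tm
  pair : Tm → Tm → Tm
  fst  : Tm → Tm
  snd  : Tm → Tm
  inl  : Tm → Tm
  inr  : Tm → Tm
  case : Tm → Tm → Tm → Tm
  bx   : {n : ℕ} → Vec Tm n → Tm → Tm

liftᵣ : (ℕ → ℕ) → ℕ → ℕ
liftᵣ ρ zero    = zero
liftᵣ ρ (suc x) = suc (ρ x)

liftᵣⁿ : ℕ → (ℕ → ℕ) → ℕ → ℕ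
liftᵣⁿ zero    ρ = ρ
liftᵣⁿ (suc n) ρ = liftᵣ (liftᵣⁿ n ρ)

mutual
  rename : (ℕ → ℕ) → Tm → Tm
  rename ρ (var x)        = var (ρ x)
  rename ρ (lam t)        = lam (rename (liftᵣ ρ) t)
  rename ρ (app t s)      = app (rename ρ t) (rename ρ s)
  rename ρ (pair t s)     = pair (rename ρ t) (rename ρ s)
  rename ρ (fst t)        = fst (rename ρ t)
  rename ρ (snd t)        = snd (rename ρ t)
  rename ρ (inl t)        = inl (rename ρ t)
  rename ρ (inr t)        = inr (rename ρ t)
  rename ρ (case t t₁ t₂) = case (rename ρ t) (rename (liftᵣ ρ) t₁) (rename (liftᵣ ρ) t₂)
  rename ρ (bx {n} ts s)  = bx (renameᵛ ρ ts) (rename (liftᵣⁿ n ρ) s)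

  renameᵛ : {n : ℕ} → (ℕ → ℕ) → Vec Tm n → Vec Tm n
  renameᵛ ρ []       = []
  renameᵛ ρ (t ∷ ts) = rename ρ t ∷ renameᵛ ρ ts

lift : (ℕ → Tm) → ℕ → Tm
lift σ zero    = var zero
lift σ (suc x) = rename suc (σ x)

liftⁿ : ℕ → (ℕ → Tm) → ℕ → Tm
liftⁿ zero    σ = σ
liftⁿ (suc n) σ = lift (liftⁿ n σ)

mutual
  subst : (ℕ → Tm) → Tm → Tm
  subst σ (var x)        = σ x
  subst σ (lam t)        = lam (subst (lift σ) t)
  subst σ (app t s)      = app (subst σ t) (subst σ s)
  subst σ (pair t s)     = pair (subst σ t) (subst σ s)
  subst σ (fst t)        = fst (subst σ t)
  subst σ (snd t)        = snd (subst σ t)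
  subst σ (inl t)        = inl (subst σ t)
  subst σ (inr t)        = inr (subst σ t)
  subst σ (case t t₁ t₂) = case (subst σ t) (subst (lift σ) t₁) (subst (lift σ) t₂)
  subst σ (bx {n} ts s)  = bx (substᵛ σ ts) (subst (liftⁿ n σ) s)

  substᵛ : {n : ℕ} → (ℕ → Tm) → Vec Tm n → Vec Tm n
  substᵛ σ []       = []
  substᵛ σ (t ∷ ts) = subst σ t ∷ substᵛ σ ts

_[_] : Tm → Tm → Tm
t [ s ] = subst σ t
  where
  σ : ℕ → Tm
  σ zero    = s
  σ (suc x) = var x

-- The outer B has binders
-- x_0 .. x_{i-1}, x_i, x_{i+1} .. x_{i+k} (0-based, n = i + 1 + k); the inner
-- B has m binders y⃗ and body u.  The result has binders
-- x_0 .. x_{i-1}, y⃗, x_{i+1} .. x_{i+k}, and x_i is replaced by u.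
bbSub : (i m k : ℕ) → Tm → ℕ → Tm
bbSub i m k u j with j <? i
... | yes _ = var j
... | no _ with j ≟ i
...   | yes _ = rename ρ u
  where
  -- in u: index l < m is y_l (now at position i + l);
  -- index m + o is outer variable o (now at position i + m + k + o)
  ρ : ℕ → ℕ
  ρ l with l <? m
  ... | yes _ = i + l
  ... | no _  = l + i + k
...   | no _ = var (j + m ∸ 1)

mutual
  infix 4 _⟶_ _⟶ᵛ_
  data _⟶_ : Tm → Tm → Set where
    β     : ∀ {t s} → app (lam t) s ⟶ t [ s ]
    π₁    : ∀ {t₁ t₂} → fst (pair t₁ t₂) ⟶ t₁
    π₂    : ∀ {t₁ t₂} → snd (pair t₁ t₂) ⟶ t₂
    ι₁    : ∀ {t t₁ t₂} → case (inl t) t₁ t₂ ⟶ t₁ [ t ]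
    ι₂    : ∀ {t t₂ t₁} → case (inr t) t₁ t₂ ⟶ t₂ [ t ]
    bb    : ∀ {i m k} (ts₁ : Vec Tm i) (ss : Vec Tm m) (u : Tm) (ts₂ : Vec Tm k) (r : Tm) →
            bx (ts₁ ++ᵛ (bx ss u ∷ ts₂)) r ⟶ bx (ts₁ ++ᵛ (ss ++ᵛ ts₂)) (subst (bbSub i m k u) r)
    bη    : ∀ {t} → bx (t ∷ []) (var zero) ⟶ t
    lamξ  : ∀ {t t'} → t ⟶ t' → lam t ⟶ lam t'
    appₗ  : ∀ {t t' s} → t ⟶ t' → app t s ⟶ app t' s
    appᵣ  : ∀ {t s s'} → s ⟶ s' → app t s ⟶ app t s'
    pairₗ : ∀ {t t' s} → t ⟶ t' → pair t s ⟶ pair t' s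
    pairᵣ : ∀ {t s s'} → s ⟶ s' → pair t s ⟶ pair t s'
    fstξ  : ∀ {t t'} → t ⟶ t' → fst t ⟶ fst t'
    sndξ  : ∀ {t t'} → t ⟶ t' → snd t ⟶ snd t'
    inlξ  : ∀ {t t'} → t ⟶ t' → inl t ⟶ inl t'
    inrξ  : ∀ {t t'} → t ⟶ t' → inr t ⟶ inr t'
    case₀ : ∀ {t t' t₁ t₂} → t ⟶ t' → case t t₁ t₂ ⟶ case t' t₁ t₂
    case₁ : ∀ {t t₁ t₁' t₂} → t₁ ⟶ t₁' → case t t₁ t₂ ⟶ case t t₁' t₂
    case₂ : ∀ {t t₁ t₂ t₂'} → t₂ ⟶ t₂' → case t t₁ t₂ ⟶ case t t₁ t₂'
    bxₗ   : ∀ {n} {ts ts' : Vec Tm n} {s} → ts ⟶ᵛ ts' → bx ts s ⟶ bx ts' s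
    bxᵣ   : ∀ {n} {ts : Vec Tm n} {s s'} → s ⟶ s' → bx ts s ⟶ bx ts s'

  data _⟶ᵛ_ : {n : ℕ} → Vec Tm n → Vec Tm n → Set where
    here  : ∀ {n t t'} {ts : Vec Tm n} → t ⟶ t' → (t ∷ ts) ⟶ᵛ (t' ∷ ts)
    there : ∀ {n t} {ts ts' : Vec Tm n} → ts ⟶ᵛ ts' → (t ∷ ts) ⟶ᵛ (t ∷ ts')

SN : Tm → Set
SN = Acc (λ u t → t ⟶ u)

data _∋_∶_ : List Ty → ℕ → Ty → Set where
  vz : ∀ {Γ A} → (A ∷ Γ) ∋ zero ∶ A
  vs : ∀ {Γ A B x} → Γ ∋ x ∶ A → (B ∷ Γ) ∋ suc x ∶ A

mutual
  infix 4 _⊢_∶_ _⊢ᵛ_∶□_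
  data _⊢_∶_ : List Ty → Tm → Ty → Set where
    ⊢var  : ∀ {Γ x A} → Γ ∋ x ∶ A → Γ ⊢ var x ∶ A
    ⊢lam  : ∀ {Γ t A B} → (A ∷ Γ) ⊢ t ∶ B → Γ ⊢ lam t ∶ (A ⇒ B)
    ⊢app  : ∀ {Γ t s A B} → Γ ⊢ t ∶ (A ⇒ B) → Γ ⊢ s ∶ A → Γ ⊢ app t s ∶ B
    ⊢pair : ∀ {Γ t s A B} → Γ ⊢ t ∶ A → Γ ⊢ s ∶ B → Γ ⊢ pair t s ∶ (A ⊗ B)
    ⊢fst  : ∀ {Γ t A B} → Γ ⊢ t ∶ (A ⊗ B) → Γ ⊢ fst t ∶ A
    ⊢snd  : ∀ {Γ t A B} → Γ ⊢ t ∶ (A ⊗ B) → Γ ⊢ snd t ∶ B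
    ⊢inl  : ∀ {Γ t A B} → Γ ⊢ t ∶ A → Γ ⊢ inl t ∶ (A ⊕ B)
    ⊢inr  : ∀ {Γ t A B} → Γ ⊢ t ∶ B → Γ ⊢ inr t ∶ (A ⊕ B)
    ⊢case : ∀ {Γ t t₁ t₂ A B C} → Γ ⊢ t ∶ (A ⊕ B) → (A ∷ Γ) ⊢ t₁ ∶ C → (B ∷ Γ) ⊢ t₂ ∶ C →
            Γ ⊢ case t t₁ t₂ ∶ C
    ⊢bx   : ∀ {Γ n B s} {ts : Vec Tm n} {As : Vec Ty n} →
            Γ ⊢ᵛ ts ∶□ As → (toList As ++ Γ) ⊢ s ∶ B → Γ ⊢ bx ts s ∶ (□ B)

  data _⊢ᵛ_∶□_ : {n : ℕ} → List Ty → Vec Tm n → Vec Ty n → Set where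
    []  : ∀ {Γ} → Γ ⊢ᵛ [] ∶□ []
    _∷_ : ∀ {Γ n t A} {ts : Vec Tm n} {As : Vec Ty n} →
          Γ ⊢ t ∶ (□ A) → Γ ⊢ᵛ ts ∶□ As → Γ ⊢ᵛ (t ∷ ts) ∶□ (A ∷ As)

-- Tait-Girard reducibility.  At a sum type a term is reducible when it is SN
-- and the contents of its injection reducts are reducible; at □B when it is SN
-- and all its unboxings are reducible at B, an unboxing being an instance
-- u[τ] of the body of a box the term reduces to, with τ unboxings of the box
-- arguments.  The new point is that a box whose body is reducible under all
-- such instances is itself SN and reducible: its argument vector is
-- well-founded under reduction and flattening (the B-B detour), because every
-- argument stays a nested argument of an SN term; and after a B-B detour the
-- body is still reducible under all instances, since instantiating the
-- detour's reduct is instantiating the eliminated binder by an unboxing.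
module Submission where

open import Defs
open import Data.Nat using (ℕ; zero; suc; _+_; _∸_; _<_; s≤s; z≤n; _<?_; _≟_)
open import Data.Nat.Properties using (m≤m+n; m<m+n; <⇒≱; <-irrefl; <-≤-trans; +-monoʳ-<; m+1+n≢m; +-assoc)
open import Data.Nat.Tactic.RingSolver using (solve-∀)
open import Data.List using (List; _∷_; _++_)
open import Data.Vec using (Vec; []; _∷_; replicate; splitAt; toList) renaming (_++_ to _++ᵛ_)
open import Data.Vec.Membership.Propositional using (_∈_)
open import Data.Vec.Relation.Unary.Any using (here; there)
open import Data.Vec.Relation.Unary.All using (All; []; _∷_)
open import Data.Vec.Relation.Binary.Pointwise.Inductive using (Pointwise; []; _∷_; ++⁺; ++⁻)
open import Data.Product using (Σ-syntax; ∃; _×_; _,_; proj₁; proj₂)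
open import Function using (_∘_; id; flip)
open import Relation.Nullary using (¬_; yes; no; contradiction)
open import Relation.Binary.PropositionalEquality
  using (_≡_; _≗_; refl; sym; trans; cong; cong₂; subst₂; module ≡-Reasoning)
  renaming (subst to transport)
open import Relation.Binary.Construct.Closure.ReflexiveTransitive using (Star; ε; _◅_)
open import Induction.WellFounded using (Acc; acc)

open ≡-Reasoning

-- Substitution

cong₃ : ∀ {A B C D : Set} (f : A → B → C → D) {a a' b b' c c'} →
        a ≡ a' → b ≡ b' → c ≡ c' → f a b c ≡ f a' b' c'
cong₃ f refl refl refl = refl

lift-var : ∀ {σ} → σ ≗ var → lift σ ≗ var
lift-var h zero    = refl
lift-var h (suc x) = cong (rename suc) (h x)

liftⁿ-var : ∀ n {σ} → σ ≗ var → liftⁿ n σ ≗ var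
liftⁿ-var zero    h = h
liftⁿ-var (suc n) h = lift-var (liftⁿ-var n h)

mutual
  subst-id : ∀ {σ} → σ ≗ var → ∀ t → subst σ t ≡ t
  subst-id h (var x)        = h x
  subst-id h (lam t)        = cong lam (subst-id (lift-var h) t)
  subst-id h (app t s)      = cong₂ app (subst-id h t) (subst-id h s)
  subst-id h (pair t s)     = cong₂ pair (subst-id h t) (subst-id h s)
  subst-id h (fst t)        = cong fst (subst-id h t)
  subst-id h (snd t)        = cong snd (subst-id h t)
  subst-id h (inl t)        = cong inl (subst-id h t)
  subst-id h (inr t)        = cong inr (subst-id h t)
  subst-id h (case t t₁ t₂) =
    cong₃ case (subst-id h t) (subst-id (lift-var h) t₁) (subst-id (lift-var h) t₂)
  subst-id h (bx {n} ts s)  = cong₂ bx (substᵛ-id h ts) (subst-id (liftⁿ-var n h) s)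

  substᵛ-id : ∀ {n σ} → σ ≗ var → (ts : Vec Tm n) → substᵛ σ ts ≡ ts
  substᵛ-id h []       = refl
  substᵛ-id h (t ∷ ts) = cong₂ _∷_ (subst-id h t) (substᵛ-id h ts)

lift-renaming : ∀ {ρ σ} → var ∘ ρ ≗ σ → var ∘ liftᵣ ρ ≗ lift σ
lift-renaming h zero    = refl
lift-renaming h (suc x) = cong (rename suc) (h x)

liftⁿ-renaming : ∀ n {ρ σ} → var ∘ ρ ≗ σ → var ∘ liftᵣⁿ n ρ ≗ liftⁿ n σ
liftⁿ-renaming zero    h = h
liftⁿ-renaming (suc n) h = lift-renaming (liftⁿ-renaming n h)

mutual
  rename-as-subst : ∀ {ρ σ} → var ∘ ρ ≗ σ → ∀ t → rename ρ t ≡ subst σ t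
  rename-as-subst h (var x)        = h x
  rename-as-subst h (lam t)        = cong lam (rename-as-subst (lift-renaming h) t)
  rename-as-subst h (app t s)      = cong₂ app (rename-as-subst h t) (rename-as-subst h s)
  rename-as-subst h (pair t s)     = cong₂ pair (rename-as-subst h t) (rename-as-subst h s)
  rename-as-subst h (fst t)        = cong fst (rename-as-subst h t)
  rename-as-subst h (snd t)        = cong snd (rename-as-subst h t)
  rename-as-subst h (inl t)        = cong inl (rename-as-subst h t)
  rename-as-subst h (inr t)        = cong inr (rename-as-subst h t)
  rename-as-subst h (case t t₁ t₂) =
    cong₃ case (rename-as-subst h t) (rename-as-subst (lift-renaming h) t₁)
               (rename-as-subst (lift-renaming h) t₂)
  rename-as-subst h (bx {n} ts s)  =
    cong₂ bx (renameᵛ-as-substᵛ h ts) (rename-as-subst (liftⁿ-renaming n h) s)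

  renameᵛ-as-substᵛ : ∀ {n ρ σ} → var ∘ ρ ≗ σ → (ts : Vec Tm n) → renameᵛ ρ ts ≡ substᵛ σ ts
  renameᵛ-as-substᵛ h []       = refl
  renameᵛ-as-substᵛ h (t ∷ ts) = cong₂ _∷_ (rename-as-subst h t) (renameᵛ-as-substᵛ h ts)

-- All composition laws come from this one traversal, run for a family of
-- triples with subst σ ∘ τ ≗ θ that is closed under lift.  It is instantiated
-- three times (τ a renaming, σ a renaming, arbitrary), each instance proving
-- closure under lift with the help of the previous ones.
module Fusion (Fuses : (ℕ → Tm) → (ℕ → Tm) → (ℕ → Tm) → Set)
              (fuses-var : ∀ {σ τ θ} → Fuses σ τ θ → subst σ ∘ τ ≗ θ)
              (fuses-lift : ∀ {σ τ θ} → Fuses σ τ θ → Fuses (lift σ) (lift τ) (lift θ))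
              where

  fuses-liftⁿ : ∀ n {σ τ θ} → Fuses σ τ θ → Fuses (liftⁿ n σ) (liftⁿ n τ) (liftⁿ n θ)
  fuses-liftⁿ zero    h = h
  fuses-liftⁿ (suc n) h = fuses-lift (fuses-liftⁿ n h)

  mutual
    subst-fusion : ∀ {σ τ θ} → Fuses σ τ θ → ∀ t → subst σ (subst τ t) ≡ subst θ t
    subst-fusion h (var x)        = fuses-var h x
    subst-fusion h (lam t)        = cong lam (subst-fusion (fuses-lift h) t)
    subst-fusion h (app t s)      = cong₂ app (subst-fusion h t) (subst-fusion h s)
    subst-fusion h (pair t s)     = cong₂ pair (subst-fusion h t) (subst-fusion h s)
    subst-fusion h (fst t)        = cong fst (subst-fusion h t)
    subst-fusion h (snd t)        = cong snd (subst-fusion h t)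
    subst-fusion h (inl t)        = cong inl (subst-fusion h t)
    subst-fusion h (inr t)        = cong inr (subst-fusion h t)
    subst-fusion h (case t t₁ t₂) =
      cong₃ case (subst-fusion h t) (subst-fusion (fuses-lift h) t₁)
                 (subst-fusion (fuses-lift h) t₂)
    subst-fusion h (bx {n} ts s)  =
      cong₂ bx (substᵛ-fusion h ts) (subst-fusion (fuses-liftⁿ n h) s)

    substᵛ-fusion : ∀ {n σ τ θ} → Fuses σ τ θ → (ts : Vec Tm n) →
                    substᵛ σ (substᵛ τ ts) ≡ substᵛ θ ts
    substᵛ-fusion h []       = refl
    substᵛ-fusion h (t ∷ ts) = cong₂ _∷_ (subst-fusion h t) (substᵛ-fusion h ts)

subst-rename : ∀ {σ ρ θ} → σ ∘ ρ ≗ θ → ∀ t → subst σ (rename ρ t) ≡ subst θ t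
subst-rename {σ} {ρ} h t =
  trans (cong (subst σ) (rename-as-subst (λ _ → refl) t)) (subst-fusion (ρ , (λ _ → refl) , h) t)
  where
  InnerRenaming : (ℕ → Tm) → (ℕ → Tm) → (ℕ → Tm) → Set
  InnerRenaming σ τ θ = Σ[ ρ ∈ (ℕ → ℕ) ] (var ∘ ρ ≗ τ × σ ∘ ρ ≗ θ)

  lift-composed : ∀ {σ ρ θ} → σ ∘ ρ ≗ θ → lift σ ∘ liftᵣ ρ ≗ lift θ
  lift-composed h zero    = refl
  lift-composed h (suc x) = cong (rename suc) (h x)

  open Fusion InnerRenaming
    (λ (_ , ρ≗τ , σρ≗θ) x → trans (cong (subst _) (sym (ρ≗τ x))) (σρ≗θ x))
    (λ (ρ , ρ≗τ , σρ≗θ) → liftᵣ ρ , lift-renaming ρ≗τ , lift-composed σρ≗θ)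

rename-id : ∀ t → rename id t ≡ t
rename-id t = trans (rename-as-subst (λ _ → refl) t) (subst-id (λ _ → refl) t)

subst-cong : ∀ {σ σ'} → σ ≗ σ' → ∀ t → subst σ t ≡ subst σ' t
subst-cong {σ} h t = trans (cong (subst σ) (sym (rename-id t))) (subst-rename h t)

rename-subst : ∀ {ρ σ θ} → rename ρ ∘ σ ≗ θ → ∀ t → rename ρ (subst σ t) ≡ subst θ t
rename-subst {ρ} {σ} h t =
  trans (rename-as-subst (λ _ → refl) (subst σ t))
        (subst-fusion (ρ , (λ _ → refl) , λ x → trans (sym (rename-as-subst (λ _ → refl) (σ x))) (h x)) t)
  where
  OuterRenaming : (ℕ → Tm) → (ℕ → Tm) → (ℕ → Tm) → Set
  OuterRenaming σ τ θ = Σ[ ρ ∈ (ℕ → ℕ) ] (var ∘ ρ ≗ σ × subst σ ∘ τ ≗ θ)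

  lift-shift : ∀ {ρ σ} → var ∘ ρ ≗ σ → ∀ u → subst (lift σ) (rename suc u) ≡ rename suc (subst σ u)
  lift-shift {ρ} {σ} h u = begin
    subst (lift σ) (rename suc u)  ≡⟨ subst-rename (λ x → cong (rename suc) (sym (h x))) u ⟩
    subst (var ∘ suc ∘ ρ) u        ≡⟨ sym (subst-rename (λ _ → refl) u) ⟩
    subst (var ∘ suc) (rename ρ u) ≡⟨ sym (rename-as-subst (λ _ → refl) (rename ρ u)) ⟩
    rename suc (rename ρ u)        ≡⟨ cong (rename suc) (rename-as-subst h u) ⟩
    rename suc (subst σ u)         ∎

  lift-composed : ∀ {ρ σ τ θ} → var ∘ ρ ≗ σ → subst σ ∘ τ ≗ θ → subst (lift σ) ∘ lift τ ≗ lift θ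
  lift-composed ρ≗σ h zero    = refl
  lift-composed {τ = τ} ρ≗σ h (suc x) = trans (lift-shift ρ≗σ (τ x)) (cong (rename suc) (h x))

  open Fusion OuterRenaming
    (λ (_ , _ , h) → h)
    (λ (ρ , ρ≗σ , h) → liftᵣ ρ , lift-renaming ρ≗σ , lift-composed ρ≗σ h)

subst-subst : ∀ {σ τ θ} → subst σ ∘ τ ≗ θ → ∀ t → subst σ (subst τ t) ≡ subst θ t
subst-subst = subst-fusion
  where
  lift-composed : ∀ {σ τ θ} → subst σ ∘ τ ≗ θ → subst (lift σ) ∘ lift τ ≗ lift θ
  lift-composed h zero    = refl
  lift-composed {σ} {τ} {θ} h (suc x) = begin
    subst (lift σ) (rename suc (τ x)) ≡⟨ subst-rename (λ _ → refl) (τ x) ⟩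
    subst (rename suc ∘ σ) (τ x)      ≡⟨ sym (rename-subst (λ _ → refl) (τ x)) ⟩
    rename suc (subst σ (τ x))        ≡⟨ cong (rename suc) (h x) ⟩
    rename suc (θ x)                  ∎

  open Fusion (λ σ τ θ → subst σ ∘ τ ≗ θ) (λ h → h) lift-composed

rename-rename : ∀ {ρ ρ' ρ''} → ρ ∘ ρ' ≗ ρ'' → ∀ t → rename ρ (rename ρ' t) ≡ rename ρ'' t
rename-rename {ρ} {ρ'} {ρ''} h t = begin
  rename ρ (rename ρ' t)          ≡⟨ rename-as-subst (λ _ → refl) (rename ρ' t) ⟩
  subst (var ∘ ρ) (rename ρ' t)   ≡⟨ subst-rename (λ x → cong var (h x)) t ⟩
  subst (var ∘ ρ'') t             ≡⟨ sym (rename-as-subst (λ _ → refl) t) ⟩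
  rename ρ'' t                    ∎

liftⁿ-< : ∀ n σ {j} → j < n → liftⁿ n σ j ≡ var j
liftⁿ-< (suc n) σ {zero}  _         = refl
liftⁿ-< (suc n) σ {suc j} (s≤s j<n) = cong (rename suc) (liftⁿ-< n σ j<n)

liftⁿ-+ : ∀ n σ x → liftⁿ n σ (n + x) ≡ rename (n +_) (σ x)
liftⁿ-+ zero    σ x = sym (rename-id (σ x))
liftⁿ-+ (suc n) σ x = trans (cong (rename suc) (liftⁿ-+ n σ x)) (rename-rename (λ _ → refl) (σ x))

infixr 5 _++ˢ_
_++ˢ_ : ∀ {n} → Vec Tm n → (ℕ → Tm) → ℕ → Tm
([]       ++ˢ σ) x       = σ x
((t ∷ ts) ++ˢ σ) zero    = t
((t ∷ ts) ++ˢ σ) (suc x) = (ts ++ˢ σ) x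

++ˢ-assoc : ∀ {a b} (xs : Vec Tm a) (ys : Vec Tm b) σ → (xs ++ᵛ ys) ++ˢ σ ≗ xs ++ˢ (ys ++ˢ σ)
++ˢ-assoc []       ys σ x       = refl
++ˢ-assoc (_ ∷ xs) ys σ zero    = refl
++ˢ-assoc (_ ∷ xs) ys σ (suc x) = ++ˢ-assoc xs ys σ x

++ˢ-+ : ∀ {n} (ts : Vec Tm n) σ x → (ts ++ˢ σ) (n + x) ≡ σ x
++ˢ-+ []       σ x = refl
++ˢ-+ (_ ∷ ts) σ x = ++ˢ-+ ts σ x

++ˢ-length : ∀ {n} (ts : Vec Tm n) σ → (ts ++ˢ σ) n ≡ σ zero
++ˢ-length []       σ = refl
++ˢ-length (_ ∷ ts) σ = ++ˢ-length ts σ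

++ˢ-< : ∀ {n} (ts : Vec Tm n) {σ σ' j} → j < n → (ts ++ˢ σ) j ≡ (ts ++ˢ σ') j
++ˢ-< (_ ∷ ts) {j = zero}  _         = refl
++ˢ-< (_ ∷ ts) {j = suc j} (s≤s j<n) = ++ˢ-< ts j<n

subst-++ˢ-liftⁿ : ∀ {n θ σ σ'} (ts : Vec Tm n) → subst θ ∘ σ ≗ σ' →
                  subst (ts ++ˢ θ) ∘ liftⁿ n σ ≗ ts ++ˢ σ'
subst-++ˢ-liftⁿ []       h x       = h x
subst-++ˢ-liftⁿ (t ∷ ts) h zero    = refl
subst-++ˢ-liftⁿ {suc n} {σ = σ} (t ∷ ts) h (suc x) =
  trans (subst-rename (λ _ → refl) (liftⁿ n σ x)) (subst-++ˢ-liftⁿ ts h x)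

instantiate-liftⁿ : ∀ {n} (ts : Vec Tm n) σ t →
                    subst (ts ++ˢ var) (subst (liftⁿ n σ) t) ≡ subst (ts ++ˢ σ) t
instantiate-liftⁿ ts σ = subst-subst (subst-++ˢ-liftⁿ ts (subst-id (λ _ → refl) ∘ σ))

[]-as-++ˢ : ∀ t s → t [ s ] ≡ subst ((s ∷ []) ++ˢ var) t
[]-as-++ˢ t s = subst-cong (λ { zero → refl ; (suc x) → refl }) t

subst-[] : ∀ σ t s → subst σ (t [ s ]) ≡ subst (lift σ) t [ subst σ s ]
subst-[] σ t s = begin
  subst σ (t [ s ])                                  ≡⟨ subst-subst (λ { zero → refl ; (suc x) → refl }) t ⟩
  subst ((subst σ s ∷ []) ++ˢ σ) t                   ≡⟨ sym (instantiate-liftⁿ (subst σ s ∷ []) σ t) ⟩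
  subst ((subst σ s ∷ []) ++ˢ var) (subst (lift σ) t) ≡⟨ sym ([]-as-++ˢ (subst (lift σ) t) (subst σ s)) ⟩
  subst (lift σ) t [ subst σ s ]                     ∎

-- The B-B detour

data Dichotomy (m : ℕ) : ℕ → Set where
  below : ∀ {l} → l < m → Dichotomy m l
  above : ∀ o → Dichotomy m (m + o)

dichotomy : ∀ m l → Dichotomy m l
dichotomy zero    l       = above l
dichotomy (suc m) zero    = below (s≤s z≤n)
dichotomy (suc m) (suc l) with dichotomy m l
... | below l<m = below (s≤s l<m)
... | above o   = above o

-- The variables of the outer box body in the B-B detour: binders before x_i,
-- x_i itself, the k binders after it, and the free variables.
data Position (i k : ℕ) : ℕ → Set where
  left  : ∀ {j} → j < i → Position i k j
  hole  : Position i k i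
  right : ∀ {d} → d < k → Position i k (i + suc d)
  outer : ∀ o → Position i k (i + suc k + o)

position : ∀ i k j → Position i k j
position zero    k zero    = hole
position zero    k (suc j) with dichotomy k j
... | below d<k = right d<k
... | above o   = outer o
position (suc i) k zero    = left (s≤s z≤n)
position (suc i) k (suc j) with position i k j
... | left j<i  = left (s≤s j<i)
... | hole      = hole
... | right d<k = right d<k
... | outer o   = outer o

-- A copy of the renaming local to bbSub, which cannot be referred to.
bbRenaming : ℕ → ℕ → ℕ → ℕ → ℕ
bbRenaming i m k l with l <? m
... | yes _ = i + l
... | no _  = l + i + k

bbRenaming-< : ∀ {i m k l} → l < m → bbRenaming i m k l ≡ i + l
bbRenaming-< {i} {m} {k} {l} l<m with l <? m
... | yes _   = refl
... | no  l≮m = contradiction l<m l≮m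

bbRenaming-+ : ∀ i m k o → bbRenaming i m k (m + o) ≡ i + (m + k) + o
bbRenaming-+ i m k o with (m + o) <? m
... | yes m+o<m = contradiction (m≤m+n m o) (<⇒≱ m+o<m)
... | no  _     = arith m o i k
  where
  arith : ∀ m o i k → m + o + i + k ≡ i + (m + k) + o
  arith = solve-∀

bbSub-left : ∀ {i m k u j} → j < i → bbSub i m k u j ≡ var j
bbSub-left {i} {j = j} j<i with j <? i
... | yes _   = refl
... | no  j≮i = contradiction j<i j≮i

bbSub-hole-var : ∀ i m k l → bbSub i m k (var l) i ≡ var (bbRenaming i m k l)
bbSub-hole-var i m k l with i <? i
... | yes i<i = contradiction i<i (<-irrefl refl)
... | no  _ with i ≟ i
...   | no  i≢i = contradiction refl i≢i
...   | yes _ with l <? m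
...     | yes _ = refl
...     | no  _ = refl

-- Generalising over the pointwise equation exposes the local renaming of bbSub.
bbSub-hole : ∀ i m k u → bbSub i m k u i ≡ rename (bbRenaming i m k) u
bbSub-hole i m k u with i <? i | bbSub-hole-var i m k
... | yes i<i | _ = contradiction i<i (<-irrefl refl)
... | no  _   | agree with i ≟ i | agree
...   | no  i≢i | _      = contradiction refl i≢i
...   | yes _   | agree′ = trans (rename-as-subst agree′ u) (sym (rename-as-subst (λ _ → refl) u))

bbSub-right : ∀ i m k u d → bbSub i m k u (i + suc d) ≡ var (i + (m + d))
bbSub-right i m k u d with (i + suc d) <? i
... | yes i+1+d<i = contradiction (m≤m+n i (suc d)) (<⇒≱ i+1+d<i)
... | no  _ with (i + suc d) ≟ i
...   | yes i+1+d≡i = contradiction i+1+d≡i (m+1+n≢m i)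
...   | no  _       = cong (λ x → var (x ∸ 1)) (arith i d m)
  where
  arith : ∀ i d m → i + suc d + m ≡ suc (i + (m + d))
  arith = solve-∀

bbSub-outer : ∀ i m k u o → bbSub i m k u (i + suc k + o) ≡ var (i + (m + k) + o)
bbSub-outer i m k u o = begin
  bbSub i m k u (i + suc k + o)   ≡⟨ cong (bbSub i m k u) (+-assoc i (suc k) o) ⟩
  bbSub i m k u (i + suc (k + o)) ≡⟨ bbSub-right i m k u (k + o) ⟩
  var (i + (m + (k + o)))         ≡⟨ cong var (arith i m k o) ⟩
  var (i + (m + k) + o)           ∎
  where
  arith : ∀ i m k o → i + (m + (k + o)) ≡ i + (m + k) + o
  arith = solve-∀

liftⁿ-bbRenaming : ∀ i m k σ →
                   liftⁿ (i + (m + k)) σ ∘ bbRenaming i m k ≗ rename (bbRenaming i m k) ∘ liftⁿ m σ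
liftⁿ-bbRenaming i m k σ l = by-cases (dichotomy m l)
  where
  N = i + (m + k)
  by-cases : ∀ {l} → Dichotomy m l → liftⁿ N σ (bbRenaming i m k l) ≡ rename (bbRenaming i m k) (liftⁿ m σ l)
  by-cases {l} (below l<m) = begin
    liftⁿ N σ (bbRenaming i m k l)           ≡⟨ cong (liftⁿ N σ) (bbRenaming-< l<m) ⟩
    liftⁿ N σ (i + l)                        ≡⟨ liftⁿ-< N σ (+-monoʳ-< i (<-≤-trans l<m (m≤m+n m k))) ⟩
    var (i + l)                              ≡⟨ cong var (sym (bbRenaming-< l<m)) ⟩
    var (bbRenaming i m k l)                 ≡⟨ cong (rename (bbRenaming i m k)) (sym (liftⁿ-< m σ l<m)) ⟩
    rename (bbRenaming i m k) (liftⁿ m σ l)  ∎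
  by-cases (above o) = begin
    liftⁿ N σ (bbRenaming i m k (m + o))             ≡⟨ cong (liftⁿ N σ) (bbRenaming-+ i m k o) ⟩
    liftⁿ N σ (N + o)                                ≡⟨ liftⁿ-+ N σ o ⟩
    rename (N +_) (σ o)                              ≡⟨ sym (rename-rename (bbRenaming-+ i m k) (σ o)) ⟩
    rename (bbRenaming i m k) (rename (m +_) (σ o))  ≡⟨ cong (rename (bbRenaming i m k)) (sym (liftⁿ-+ m σ o)) ⟩
    rename (bbRenaming i m k) (liftⁿ m σ (m + o))    ∎

subst-bbSub : ∀ i m k u σ r →
  subst (liftⁿ (i + (m + k)) σ) (subst (bbSub i m k u) r)
  ≡ subst (bbSub i m k (subst (liftⁿ m σ) u)) (subst (liftⁿ (i + suc k) σ) r)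
subst-bbSub i m k u σ r = trans (subst-subst commute r) (sym (subst-subst (λ _ → refl) r))
  where
  N  = i + (m + k)
  N′ = i + suc k
  u′ = subst (liftⁿ m σ) u
  B  = bbSub i m k u
  B′ = bbSub i m k u′

  commute : subst (liftⁿ N σ) ∘ B ≗ subst B′ ∘ liftⁿ N′ σ
  commute j with position i k j
  ... | left j<i = begin
    subst (liftⁿ N σ) (B j)  ≡⟨ cong (subst (liftⁿ N σ)) (bbSub-left j<i) ⟩
    liftⁿ N σ j              ≡⟨ liftⁿ-< N σ (<-≤-trans j<i (m≤m+n i (m + k))) ⟩
    var j                    ≡⟨ sym (bbSub-left j<i) ⟩
    B′ j                     ≡⟨ cong (subst B′) (sym (liftⁿ-< N′ σ (<-≤-trans j<i (m≤m+n i (suc k))))) ⟩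
    subst B′ (liftⁿ N′ σ j)  ∎
  ... | hole = begin
    subst (liftⁿ N σ) (B i)                          ≡⟨ cong (subst (liftⁿ N σ)) (bbSub-hole i m k u) ⟩
    subst (liftⁿ N σ) (rename (bbRenaming i m k) u)  ≡⟨ subst-rename (liftⁿ-bbRenaming i m k σ) u ⟩
    subst (rename (bbRenaming i m k) ∘ liftⁿ m σ) u  ≡⟨ sym (rename-subst (λ _ → refl) u) ⟩
    rename (bbRenaming i m k) u′                     ≡⟨ sym (bbSub-hole i m k u′) ⟩
    B′ i                                             ≡⟨ cong (subst B′) (sym (liftⁿ-< N′ σ (m<m+n i (s≤s z≤n)))) ⟩
    subst B′ (liftⁿ N′ σ i)                          ∎
  ... | right {d} d<k = begin
    subst (liftⁿ N σ) (B (i + suc d))  ≡⟨ cong (subst (liftⁿ N σ)) (bbSub-right i m k u d) ⟩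
    liftⁿ N σ (i + (m + d))            ≡⟨ liftⁿ-< N σ (+-monoʳ-< i (+-monoʳ-< m d<k)) ⟩
    var (i + (m + d))                  ≡⟨ sym (bbSub-right i m k u′ d) ⟩
    B′ (i + suc d)                     ≡⟨ cong (subst B′) (sym (liftⁿ-< N′ σ (+-monoʳ-< i (s≤s d<k)))) ⟩
    subst B′ (liftⁿ N′ σ (i + suc d))  ∎
  ... | outer o = begin
    subst (liftⁿ N σ) (B (N′ + o))    ≡⟨ cong (subst (liftⁿ N σ)) (bbSub-outer i m k u o) ⟩
    liftⁿ N σ (N + o)                 ≡⟨ liftⁿ-+ N σ o ⟩
    rename (N +_) (σ o)               ≡⟨ rename-as-subst (λ _ → refl) (σ o) ⟩
    subst (var ∘ (N +_)) (σ o)        ≡⟨ sym (subst-rename (bbSub-outer i m k u′) (σ o)) ⟩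
    subst B′ (rename (N′ +_) (σ o))   ≡⟨ cong (subst B′) (sym (liftⁿ-+ N′ σ o)) ⟩
    subst B′ (liftⁿ N′ σ (N′ + o))    ∎

++ˢ-bbRenaming : ∀ {i m k} (τ₁ : Vec Tm i) (τs : Vec Tm m) (τ₂ : Vec Tm k) θ →
                 ((τ₁ ++ᵛ (τs ++ᵛ τ₂)) ++ˢ θ) ∘ bbRenaming i m k ≗ τs ++ˢ θ
++ˢ-bbRenaming {i} {m} {k} τ₁ τs τ₂ θ l = by-cases (dichotomy m l)
  where
  Env = (τ₁ ++ᵛ (τs ++ᵛ τ₂)) ++ˢ θ
  by-cases : ∀ {l} → Dichotomy m l → Env (bbRenaming i m k l) ≡ (τs ++ˢ θ) l
  by-cases {l} (below l<m) = begin
    Env (bbRenaming i m k l)               ≡⟨ cong Env (bbRenaming-< l<m) ⟩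
    Env (i + l)                            ≡⟨ ++ˢ-assoc τ₁ (τs ++ᵛ τ₂) θ (i + l) ⟩
    (τ₁ ++ˢ ((τs ++ᵛ τ₂) ++ˢ θ)) (i + l)   ≡⟨ ++ˢ-+ τ₁ _ l ⟩
    ((τs ++ᵛ τ₂) ++ˢ θ) l                  ≡⟨ ++ˢ-assoc τs τ₂ θ l ⟩
    (τs ++ˢ (τ₂ ++ˢ θ)) l                  ≡⟨ ++ˢ-< τs l<m ⟩
    (τs ++ˢ θ) l                           ∎
  by-cases (above o) = begin
    Env (bbRenaming i m k (m + o))  ≡⟨ cong Env (bbRenaming-+ i m k o) ⟩
    Env (i + (m + k) + o)           ≡⟨ ++ˢ-+ (τ₁ ++ᵛ (τs ++ᵛ τ₂)) θ o ⟩
    θ o                             ≡⟨ sym (++ˢ-+ τs θ o) ⟩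
    (τs ++ˢ θ) (m + o)              ∎

instantiate-bbSub : ∀ {i m k} (τ₁ : Vec Tm i) (τs : Vec Tm m) (τ₂ : Vec Tm k) θ u r →
  subst ((τ₁ ++ᵛ (τs ++ᵛ τ₂)) ++ˢ θ) (subst (bbSub i m k u) r)
  ≡ subst ((τ₁ ++ᵛ (subst (τs ++ˢ θ) u ∷ τ₂)) ++ˢ θ) r
instantiate-bbSub {i} {m} {k} τ₁ τs τ₂ θ u = subst-subst instantiate
  where
  Env  = (τ₁ ++ᵛ (τs ++ᵛ τ₂)) ++ˢ θ
  x    = subst (τs ++ˢ θ) u
  Env′ = (τ₁ ++ᵛ (x ∷ τ₂)) ++ˢ θ

  instantiate : subst Env ∘ bbSub i m k u ≗ Env′
  instantiate j with position i k j
  ... | left j<i = begin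
    subst Env (bbSub i m k u j)     ≡⟨ cong (subst Env) (bbSub-left j<i) ⟩
    Env j                           ≡⟨ ++ˢ-assoc τ₁ _ θ j ⟩
    (τ₁ ++ˢ ((τs ++ᵛ τ₂) ++ˢ θ)) j  ≡⟨ ++ˢ-< τ₁ j<i ⟩
    (τ₁ ++ˢ ((x ∷ τ₂) ++ˢ θ)) j     ≡⟨ sym (++ˢ-assoc τ₁ _ θ j) ⟩
    Env′ j                          ∎
  ... | hole = begin
    subst Env (bbSub i m k u i)              ≡⟨ cong (subst Env) (bbSub-hole i m k u) ⟩
    subst Env (rename (bbRenaming i m k) u)  ≡⟨ subst-rename (++ˢ-bbRenaming τ₁ τs τ₂ θ) u ⟩
    subst (τs ++ˢ θ) u                       ≡⟨ sym (++ˢ-length τ₁ _) ⟩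
    (τ₁ ++ˢ ((x ∷ τ₂) ++ˢ θ)) i              ≡⟨ sym (++ˢ-assoc τ₁ _ θ i) ⟩
    Env′ i                                   ∎
  ... | right {d} _ = begin
    subst Env (bbSub i m k u (i + suc d))       ≡⟨ cong (subst Env) (bbSub-right i m k u d) ⟩
    Env (i + (m + d))                           ≡⟨ ++ˢ-assoc τ₁ _ θ (i + (m + d)) ⟩
    (τ₁ ++ˢ ((τs ++ᵛ τ₂) ++ˢ θ)) (i + (m + d))  ≡⟨ ++ˢ-+ τ₁ _ (m + d) ⟩
    ((τs ++ᵛ τ₂) ++ˢ θ) (m + d)                 ≡⟨ ++ˢ-assoc τs τ₂ θ (m + d) ⟩
    (τs ++ˢ (τ₂ ++ˢ θ)) (m + d)                 ≡⟨ ++ˢ-+ τs _ d ⟩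
    (τ₂ ++ˢ θ) d                                ≡⟨ sym (++ˢ-+ τ₁ _ (suc d)) ⟩
    (τ₁ ++ˢ ((x ∷ τ₂) ++ˢ θ)) (i + suc d)       ≡⟨ sym (++ˢ-assoc τ₁ _ θ (i + suc d)) ⟩
    Env′ (i + suc d)                            ∎
  ... | outer o = begin
    subst Env (bbSub i m k u (i + suc k + o))  ≡⟨ cong (subst Env) (bbSub-outer i m k u o) ⟩
    Env (i + (m + k) + o)                      ≡⟨ ++ˢ-+ (τ₁ ++ᵛ (τs ++ᵛ τ₂)) θ o ⟩
    θ o                                        ≡⟨ sym (++ˢ-+ (τ₁ ++ᵛ (x ∷ τ₂)) θ o) ⟩
    Env′ (i + suc k + o)                       ∎

-- Reduction under substitution

substᵛ-++ : ∀ {a b} σ (xs : Vec Tm a) (ys : Vec Tm b) → substᵛ σ (xs ++ᵛ ys) ≡ substᵛ σ xs ++ᵛ substᵛ σ ys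
substᵛ-++ σ []       ys = refl
substᵛ-++ σ (x ∷ xs) ys = cong (subst σ x ∷_) (substᵛ-++ σ xs ys)

mutual
  subst-⟶ : ∀ σ {t t'} → t ⟶ t' → subst σ t ⟶ subst σ t'
  subst-⟶ σ (β {t} {s})        = transport (subst σ (app (lam t) s) ⟶_) (sym (subst-[] σ t s)) β
  subst-⟶ σ π₁                 = π₁
  subst-⟶ σ π₂                 = π₂
  subst-⟶ σ (ι₁ {t} {t₁} {t₂}) = transport (subst σ (case (inl t) t₁ t₂) ⟶_) (sym (subst-[] σ t₁ t)) ι₁
  subst-⟶ σ (ι₂ {t} {t₂} {t₁}) = transport (subst σ (case (inr t) t₁ t₂) ⟶_) (sym (subst-[] σ t₂ t)) ι₂
  subst-⟶ σ (bb {i} {m} {k} ts₁ ss u ts₂ r) =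
    subst₂ _⟶_ (cong (λ ts → bx ts r′) (sym redex-args))
               (cong₂ bx (sym reduct-args) (sym (subst-bbSub i m k u σ r)))
               (bb (substᵛ σ ts₁) (substᵛ σ ss) (subst (liftⁿ m σ) u) (substᵛ σ ts₂) r′)
    where
    r′ = subst (liftⁿ (i + suc k) σ) r
    redex-args : substᵛ σ (ts₁ ++ᵛ (bx ss u ∷ ts₂))
                 ≡ substᵛ σ ts₁ ++ᵛ (bx (substᵛ σ ss) (subst (liftⁿ m σ) u) ∷ substᵛ σ ts₂)
    redex-args = substᵛ-++ σ ts₁ (bx ss u ∷ ts₂)
    reduct-args : substᵛ σ (ts₁ ++ᵛ (ss ++ᵛ ts₂)) ≡ substᵛ σ ts₁ ++ᵛ (substᵛ σ ss ++ᵛ substᵛ σ ts₂)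
    reduct-args = trans (substᵛ-++ σ ts₁ (ss ++ᵛ ts₂)) (cong (substᵛ σ ts₁ ++ᵛ_) (substᵛ-++ σ ss ts₂))
  subst-⟶ σ bη             = bη
  subst-⟶ σ (lamξ st)      = lamξ (subst-⟶ (lift σ) st)
  subst-⟶ σ (appₗ st)      = appₗ (subst-⟶ σ st)
  subst-⟶ σ (appᵣ st)      = appᵣ (subst-⟶ σ st)
  subst-⟶ σ (pairₗ st)     = pairₗ (subst-⟶ σ st)
  subst-⟶ σ (pairᵣ st)     = pairᵣ (subst-⟶ σ st)
  subst-⟶ σ (fstξ st)      = fstξ (subst-⟶ σ st)
  subst-⟶ σ (sndξ st)      = sndξ (subst-⟶ σ st)
  subst-⟶ σ (inlξ st)      = inlξ (subst-⟶ σ st)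
  subst-⟶ σ (inrξ st)      = inrξ (subst-⟶ σ st)
  subst-⟶ σ (case₀ st)     = case₀ (subst-⟶ σ st)
  subst-⟶ σ (case₁ st)     = case₁ (subst-⟶ (lift σ) st)
  subst-⟶ σ (case₂ st)     = case₂ (subst-⟶ (lift σ) st)
  subst-⟶ σ (bxₗ st)       = bxₗ (substᵛ-⟶ σ st)
  subst-⟶ σ (bxᵣ {n} st)   = bxᵣ (subst-⟶ (liftⁿ n σ) st)

  substᵛ-⟶ : ∀ σ {n} {ts ts' : Vec Tm n} → ts ⟶ᵛ ts' → substᵛ σ ts ⟶ᵛ substᵛ σ ts'
  substᵛ-⟶ σ (here st)  = here (subst-⟶ σ st)
  substᵛ-⟶ σ (there st) = there (substᵛ-⟶ σ st)

infix 4 _⟶*_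
_⟶*_ : Tm → Tm → Set
_⟶*_ = Star _⟶_

SN-preimage : (f : Tm → Tm) → (∀ {a b} → a ⟶ b → f a ⟶ f b) → ∀ {t} → SN (f t) → SN t
SN-preimage f f-⟶ (acc rs) = acc (λ st → SN-preimage f f-⟶ (rs (f-⟶ st)))

SN-subst : ∀ σ {t} → SN (subst σ t) → SN t
SN-subst σ = SN-preimage (subst σ) (subst-⟶ σ)

module Injection (c : Tm → Tm) (c-⟶ : ∀ {a a'} → a ⟶ a' → c a ⟶ c a')
                 (c-⟶-inv : ∀ {a w} → c a ⟶ w → Σ[ a' ∈ Tm ] (a ⟶ a' × w ≡ c a')) where

  SN-injection : ∀ {a} → SN a → SN (c a)
  SN-injection (acc rs) = acc λ st → reduct (c-⟶-inv st)
    where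
    reduct : ∀ {w} → Σ[ a' ∈ Tm ] (_ ⟶ a' × w ≡ c a') → SN w
    reduct (_ , st , refl) = SN-injection (rs st)

  injection-⟶* : ∀ {a w} → c a ⟶* w → Σ[ a' ∈ Tm ] (a ⟶* a' × w ≡ c a')
  injection-⟶* ε          = _ , ε , refl
  injection-⟶* (st ◅ st*) with c-⟶-inv st
  ... | _ , st′ , refl with injection-⟶* st*
  ...   | a' , st*′ , eq = a' , st′ ◅ st*′ , eq

inl-⟶-inv : ∀ {a w} → inl a ⟶ w → Σ[ a' ∈ Tm ] (a ⟶ a' × w ≡ inl a')
inl-⟶-inv (inlξ st) = _ , st , refl

inr-⟶-inv : ∀ {a w} → inr a ⟶ w → Σ[ a' ∈ Tm ] (a ⟶ a' × w ≡ inr a')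
inr-⟶-inv (inrξ st) = _ , st , refl

open Injection inl inlξ inl-⟶-inv
  renaming (SN-injection to SN-inl; injection-⟶* to inl-⟶*)
open Injection inr inrξ inr-⟶-inv
  renaming (SN-injection to SN-inr; injection-⟶* to inr-⟶*)

-- Reducibility

-- Variables are unboxings of anything, so that the body of a box can always be
-- instantiated (by variables).
data Unboxing (t : Tm) : Tm → Set where
  var-unboxing : ∀ x → Unboxing t (var x)
  box-unboxing : ∀ {n} {ss : Vec Tm n} {u} → t ⟶* bx ss u →
                 {τ : Vec Tm n} → Pointwise Unboxing ss τ → Unboxing t (subst (τ ++ˢ var) u)

Red : Ty → Tm → Set
Red (atom _) t = SN t
Red (A ⇒ B)  t = ∀ s → Red A s → Red B (app t s)
Red (A ⊗ B)  t = Red A (fst t) × Red B (snd t)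
Red (A ⊕ B)  t = SN t × (∀ u → t ⟶* inl u → Red A u) × (∀ u → t ⟶* inr u → Red B u)
Red (□ B)    t = SN t × (∀ v → Unboxing t v → Red B v)

data Neutral : Tm → Set where
  var  : ∀ {x} → Neutral (var x)
  app  : ∀ {t s} → Neutral (app t s)
  fst  : ∀ {t} → Neutral (fst t)
  snd  : ∀ {t} → Neutral (snd t)
  case : ∀ {t t₁ t₂} → Neutral (case t t₁ t₂)

Unboxing-⟵ : ∀ {t t' v} → t ⟶ t' → Unboxing t' v → Unboxing t v
Unboxing-⟵ st (var-unboxing x)      = var-unboxing x
Unboxing-⟵ st (box-unboxing st* us) = box-unboxing (st ◅ st*) us

Red-⟶ : ∀ A {t t'} → Red A t → t ⟶ t' → Red A t'
Red-⟶ (atom _) (acc rs)         st = rs st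
Red-⟶ (A ⇒ B)  r                st s rs = Red-⟶ B (r s rs) (appₗ st)
Red-⟶ (A ⊗ B)  (r₁ , r₂)        st = Red-⟶ A r₁ (fstξ st) , Red-⟶ B r₂ (sndξ st)
Red-⟶ (A ⊕ B)  (acc rs , f , g) st = rs st , (λ u st* → f u (st ◅ st*)) , (λ u st* → g u (st ◅ st*))
Red-⟶ (□ B)    (acc rs , f)     st = rs st , (λ v us → f v (Unboxing-⟵ st us))

Red-⟶* : ∀ A {t t'} → Red A t → t ⟶* t' → Red A t'
Red-⟶* A r ε          = r
Red-⟶* A r (st ◅ st*) = Red-⟶* A (Red-⟶ A r st) st*

first-step : ∀ {t w} → Neutral t → ¬ Neutral w → t ⟶* w → Σ[ t' ∈ Tm ] (t ⟶ t' × t' ⟶* w)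
first-step ne ¬ne ε          = contradiction ne ¬ne
first-step ne ¬ne (st ◅ st*) = _ , st , st*

mutual
  Red⇒SN : ∀ A {t} → Red A t → SN t
  Red⇒SN (atom _) r       = r
  Red⇒SN (A ⇒ B)  r       = SN-preimage (λ t → app t (var 0)) appₗ (Red⇒SN B (r (var 0) (Red-var A 0)))
  Red⇒SN (A ⊗ B)  (r , _) = SN-preimage fst fstξ (Red⇒SN A r)
  Red⇒SN (A ⊕ B)  (sn , _) = sn
  Red⇒SN (□ B)    (sn , _) = sn

  Red-neutral : ∀ A {t} → Neutral t → (∀ {t'} → t ⟶ t' → Red A t') → Red A t
  Red-neutral (atom _) ne h = acc h
  Red-neutral (A ⇒ B) ne h s r = Red-neutral B app (app-reduct ne h (Red⇒SN A r) r)
    where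
    app-reduct : ∀ {t s} → Neutral t → (∀ {t'} → t ⟶ t' → Red (A ⇒ B) t') →
                 SN s → Red A s → ∀ {w} → app t s ⟶ w → Red B w
    app-reduct () _ _        _ β
    app-reduct _  h _        r (appₗ st) = h st _ r
    app-reduct ne h (acc rs) r (appᵣ st) = Red-neutral B app (app-reduct ne h (rs st) (Red-⟶ A r st))
  Red-neutral (A ⊗ B) ne h = Red-neutral A fst (fst-reduct ne h) , Red-neutral B snd (snd-reduct ne h)
    where
    fst-reduct : ∀ {t} → Neutral t → (∀ {t'} → t ⟶ t' → Red (A ⊗ B) t') → ∀ {w} → fst t ⟶ w → Red A w
    fst-reduct () _ π₁
    fst-reduct _  h (fstξ st) = proj₁ (h st)
    snd-reduct : ∀ {t} → Neutral t → (∀ {t'} → t ⟶ t' → Red (A ⊗ B) t') → ∀ {w} → snd t ⟶ w → Red B w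
    snd-reduct () _ π₂
    snd-reduct _  h (sndξ st) = proj₂ (h st)
  Red-neutral (A ⊕ B) ne h = acc (proj₁ ∘ h) , inl-reduct , inr-reduct
    where
    inl-reduct : ∀ u → _ ⟶* inl u → Red A u
    inl-reduct u st* with first-step ne (λ ()) st*
    ... | _ , st , st*′ = proj₁ (proj₂ (h st)) u st*′
    inr-reduct : ∀ u → _ ⟶* inr u → Red B u
    inr-reduct u st* with first-step ne (λ ()) st*
    ... | _ , st , st*′ = proj₂ (proj₂ (h st)) u st*′
  Red-neutral (□ B) ne h = acc (proj₁ ∘ h) , unboxing
    where
    unboxing : ∀ v → Unboxing _ v → Red B v
    unboxing _ (var-unboxing x)      = Red-var B x
    unboxing _ (box-unboxing st* us) with first-step ne (λ ()) st*
    ... | _ , st , st*′ = proj₂ (h st) _ (box-unboxing st*′ us)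

  Red-var : ∀ A x → Red A (var x)
  Red-var A x = Red-neutral A var (λ ())

-- Boxes

infix 4 _⇝_
data _⇝_ : ∃ (Vec Tm) → ∃ (Vec Tm) → Set where
  head-⟶  : ∀ {n t t'} {ts : Vec Tm n} → t ⟶ t' → (_ , t ∷ ts) ⇝ (_ , t' ∷ ts)
  flatten : ∀ {n m} {ss : Vec Tm m} {u} {ts : Vec Tm n} → (_ , bx ss u ∷ ts) ⇝ (_ , ss ++ᵛ ts)
  tail-⇝  : ∀ {n m t} {ts : Vec Tm n} {ts' : Vec Tm m} → (_ , ts) ⇝ (_ , ts') → (_ , t ∷ ts) ⇝ (_ , t ∷ ts')

SNᵛ : ∀ {n} → Vec Tm n → Set
SNᵛ ts = Acc (flip _⇝_) (_ , ts)

⟶ᵛ⇒⇝ : ∀ {n} {ts ts' : Vec Tm n} → ts ⟶ᵛ ts' → (_ , ts) ⇝ (_ , ts')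
⟶ᵛ⇒⇝ (here st)  = head-⟶ st
⟶ᵛ⇒⇝ (there st) = tail-⇝ (⟶ᵛ⇒⇝ st)

flatten-at : ∀ {i m k} (ts₁ : Vec Tm i) {ss : Vec Tm m} {u} {ts₂ : Vec Tm k} →
             (_ , ts₁ ++ᵛ (bx ss u ∷ ts₂)) ⇝ (_ , ts₁ ++ᵛ (ss ++ᵛ ts₂))
flatten-at []        = flatten
flatten-at (_ ∷ ts₁) = tail-⇝ (flatten-at ts₁)

SNᵛ-head : ∀ {n t} {ts : Vec Tm n} → SNᵛ (t ∷ ts) → SN t
SNᵛ-head (acc rs) = acc (λ st → SNᵛ-head (rs (head-⟶ st)))

infix 4 _⊴_
data _⊴_ : Tm → Tm → Set where
  ⊴-refl : ∀ {t} → t ⊴ t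
  ⊴-arg  : ∀ {n} {ss : Vec Tm n} {u x s} → s ⊴ x → x ∈ ss → s ⊴ bx ss u

⊴-trans : ∀ {a b c} → a ⊴ b → b ⊴ c → a ⊴ c
⊴-trans a⊴b ⊴-refl          = a⊴b
⊴-trans a⊴b (⊴-arg b⊴x x∈) = ⊴-arg (⊴-trans a⊴b b⊴x) x∈

∈-⟶ : ∀ {n x x'} {ss : Vec Tm n} → x ∈ ss → x ⟶ x' → Σ[ ss' ∈ Vec Tm n ] (ss ⟶ᵛ ss' × x' ∈ ss')
∈-⟶ (here refl) st = _ , here st , here refl
∈-⟶ (there x∈)  st with ∈-⟶ x∈ st
... | _ , st′ , x'∈ = _ , there st′ , there x'∈

⊴-⟶ : ∀ {s t s'} → s ⊴ t → s ⟶ s' → Σ[ t' ∈ Tm ] (t ⟶ t' × s' ⊴ t')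
⊴-⟶ ⊴-refl            st = _ , st , ⊴-refl
⊴-⟶ (⊴-arg s⊴x x∈) st with ⊴-⟶ s⊴x st
... | _ , st′ , s'⊴x' with ∈-⟶ x∈ st′
...   | _ , stᵛ , x'∈ = _ , bxₗ stᵛ , ⊴-arg s'⊴x' x'∈

-- An entry s is accessible as long as it is a nested argument of some SN term
-- t: a step of s is a step of t, and flattening s replaces it by structurally
-- smaller terms that are still nested arguments of t.
mutual
  SNᵛ-∷ : ∀ {t s} → SN t → s ⊴ t → ∀ {n} {ts : Vec Tm n} → SNᵛ ts → SNᵛ (s ∷ ts)
  SNᵛ-∷ sn s⊴t snᵛ = acc (SNᵛ-∷-⇝ sn s⊴t snᵛ)

  SNᵛ-∷-⇝ : ∀ {t s} → SN t → s ⊴ t → ∀ {n} {ts : Vec Tm n} → SNᵛ ts →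
            ∀ {y} → (_ , s ∷ ts) ⇝ y → Acc (flip _⇝_) y
  SNᵛ-∷-⇝ (acc rs) s⊴t snᵛ (head-⟶ st) with ⊴-⟶ s⊴t st
  ... | _ , st′ , s'⊴t' = SNᵛ-∷ (rs st′) s'⊴t' snᵛ
  SNᵛ-∷-⇝ {s = bx ss u} sn s⊴t snᵛ flatten = SNᵛ-++ sn ss (λ x∈ → ⊴-trans (⊴-arg ⊴-refl x∈) s⊴t) snᵛ
  SNᵛ-∷-⇝ sn s⊴t (acc rs) (tail-⇝ st) = SNᵛ-∷ sn s⊴t (rs st)

  SNᵛ-++ : ∀ {t} → SN t → ∀ {m} (ss : Vec Tm m) → (∀ {x} → x ∈ ss → x ⊴ t) →
           ∀ {n} {ts : Vec Tm n} → SNᵛ ts → SNᵛ (ss ++ᵛ ts)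
  SNᵛ-++ sn []       _    snᵛ = snᵛ
  SNᵛ-++ sn (x ∷ ss) ss⊴t snᵛ = SNᵛ-∷ sn (ss⊴t (here refl)) (SNᵛ-++ sn ss (ss⊴t ∘ there) snᵛ)

All-SN⇒SNᵛ : ∀ {n} {ts : Vec Tm n} → All SN ts → SNᵛ ts
All-SN⇒SNᵛ []         = acc (λ ())
All-SN⇒SNᵛ (sn ∷ sns) = SNᵛ-∷ sn ⊴-refl (All-SN⇒SNᵛ sns)

RedBody : Ty → ∀ {n} → Vec Tm n → Tm → Set
RedBody B {n} ts r = ∀ {τ : Vec Tm n} → Pointwise Unboxing ts τ → Red B (subst (τ ++ˢ var) r)

Unboxings-⟵ : ∀ {n} {ts ts' τ : Vec Tm n} → ts ⟶ᵛ ts' → Pointwise Unboxing ts' τ → Pointwise Unboxing ts τ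
Unboxings-⟵ (here st)  (w ∷ ws) = Unboxing-⟵ st w ∷ ws
Unboxings-⟵ (there st) (w ∷ ws) = w ∷ Unboxings-⟵ st ws

Unboxings-++⁻ : ∀ {a b} (xs : Vec Tm a) {ys : Vec Tm b} {τ : Vec Tm (a + b)} →
                Pointwise Unboxing (xs ++ᵛ ys) τ →
                Σ[ τ₁ ∈ Vec Tm a ] Σ[ τ₂ ∈ Vec Tm b ]
                  (τ ≡ τ₁ ++ᵛ τ₂ × Pointwise Unboxing xs τ₁ × Pointwise Unboxing ys τ₂)
Unboxings-++⁻ {a} xs {τ = τ} ws with splitAt a τ
... | τ₁ , τ₂ , refl = τ₁ , τ₂ , refl , ++⁻ xs τ₁ ws

var-unboxings : ∀ {n} (ts : Vec Tm n) → Pointwise Unboxing ts (replicate n (var 0))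
var-unboxings []       = []
var-unboxings (_ ∷ ts) = var-unboxing 0 ∷ var-unboxings ts

RedBody-args-⟶ : ∀ B {n} {ts ts' : Vec Tm n} {r} → ts ⟶ᵛ ts' → RedBody B ts r → RedBody B ts' r
RedBody-args-⟶ B st red ws = red (Unboxings-⟵ st ws)

RedBody-⟶ : ∀ B {n} {ts : Vec Tm n} {r r'} → r ⟶ r' → RedBody B ts r → RedBody B ts r'
RedBody-⟶ B st red {τ} ws = Red-⟶ B (red ws) (subst-⟶ (τ ++ˢ var) st)

RedBody-bb : ∀ B {i m k} (ts₁ : Vec Tm i) (ss : Vec Tm m) u (ts₂ : Vec Tm k) r →
             RedBody B (ts₁ ++ᵛ (bx ss u ∷ ts₂)) r → RedBody B (ts₁ ++ᵛ (ss ++ᵛ ts₂)) (subst (bbSub i m k u) r)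
RedBody-bb B ts₁ ss u ts₂ r red ws with Unboxings-++⁻ ts₁ ws
... | τ₁ , _ , refl , ws₁ , ws′ with Unboxings-++⁻ ss ws′
...   | τs , τ₂ , refl , wss , ws₂ =
  transport (Red B) (sym (instantiate-bbSub τ₁ τs τ₂ var u r))
    (red (++⁺ ws₁ (box-unboxing ε wss ∷ ws₂)))

RedBody⇒SN : ∀ B {n} {ts : Vec Tm n} {r} → RedBody B ts r → SN r
RedBody⇒SN B {n} {ts} red = SN-subst (replicate n (var 0) ++ˢ var) (Red⇒SN B (red (var-unboxings ts)))

Red-unboxing-of-box : ∀ B {n} {ts : Vec Tm n} {r m} {ss : Vec Tm m} {u} {τ : Vec Tm m} →
                      RedBody B ts r → bx ts r ⟶* bx ss u → Pointwise Unboxing ss τ → Red B (subst (τ ++ˢ var) u)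
Red-unboxing-of-box B red ε ws = red ws
Red-unboxing-of-box B {r = r} red (bxₗ st ◅ st*) ws =
  Red-unboxing-of-box B (RedBody-args-⟶ B {r = r} st red) st* ws
Red-unboxing-of-box B {ts = ts} red (bxᵣ st ◅ st*) ws =
  Red-unboxing-of-box B (RedBody-⟶ B {ts = ts} st red) st* ws
Red-unboxing-of-box B red (bb ts₁ ss u ts₂ r ◅ st*) ws =
  Red-unboxing-of-box B (RedBody-bb B ts₁ ss u ts₂ r red) st* ws
Red-unboxing-of-box B red (bη ◅ st*) ws = red (box-unboxing st* ws ∷ [])

SN-box : ∀ B {n} {ts : Vec Tm n} {r} → SNᵛ ts → RedBody B ts r → SN r → SN (bx ts r)
SN-box B snᵛ red snr = acc (reduct snᵛ red snr)
  where
  reduct : ∀ {n} {ts : Vec Tm n} {r} → SNᵛ ts → RedBody B ts r → SN r → ∀ {w} → bx ts r ⟶ w → SN w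
  reduct {r = r} (acc rs) red snr (bxₗ st) = SN-box B (rs (⟶ᵛ⇒⇝ st)) (RedBody-args-⟶ B {r = r} st red) snr
  reduct {ts = ts} snᵛ red (acc rs) (bxᵣ st) = SN-box B snᵛ (RedBody-⟶ B {ts = ts} st red) (rs st)
  reduct (acc rs) red snr (bb ts₁ ss u ts₂ r) =
    SN-box B (rs (flatten-at ts₁)) red′ (RedBody⇒SN B red′)
    where red′ = RedBody-bb B ts₁ ss u ts₂ r red
  reduct snᵛ red snr bη = SNᵛ-head snᵛ

Red-box : ∀ B {n} {ts : Vec Tm n} {r} → SNᵛ ts → RedBody B ts r → Red (□ B) (bx ts r)
Red-box B snᵛ red = SN-box B snᵛ red (RedBody⇒SN B red) , unboxing
  where
  unboxing : ∀ v → Unboxing _ v → Red B v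
  unboxing _ (var-unboxing x)      = Red-var B x
  unboxing _ (box-unboxing st* ws) = Red-unboxing-of-box B red st* ws

-- The fundamental lemma

[]-lift : ∀ σ t a → subst (lift σ) t [ a ] ≡ subst ((a ∷ []) ++ˢ σ) t
[]-lift σ t a = trans ([]-as-++ˢ (subst (lift σ) t) a) (instantiate-liftⁿ (a ∷ []) σ t)

SN-of-Red-instances : ∀ A C {b} → (∀ a → Red A a → Red C (b [ a ])) → SN b
SN-of-Red-instances A C H = SN-subst _ (Red⇒SN C (H (var 0) (Red-var A 0)))

Red-β : ∀ A B {b s} → SN b → SN s → (∀ a → Red A a → Red B (b [ a ])) → Red A s → Red B (app (lam b) s)
Red-β A B snb sns H r = Red-neutral B app (reduct snb sns H r)
  where
  reduct : ∀ {b s} → SN b → SN s → (∀ a → Red A a → Red B (b [ a ])) → Red A s → ∀ {w} → app (lam b) s ⟶ w → Red B w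
  reduct _        _        H r β                = H _ r
  reduct (acc rs) sns      H r (appₗ (lamξ st)) = Red-β A B (rs st) sns (λ a ra → Red-⟶ B (H a ra) (subst-⟶ _ st)) r
  reduct snb      (acc rs) H r (appᵣ st)        = Red-β A B snb (rs st) H (Red-⟶ A r st)

Red-pair : ∀ A B {a b} → Red A a → Red B b → Red (A ⊗ B) (pair a b)
Red-pair A B ra rb = Red-neutral A fst (fst-reduct (Red⇒SN A ra) (Red⇒SN B rb) ra)
                   , Red-neutral B snd (snd-reduct (Red⇒SN A ra) (Red⇒SN B rb) rb)
  where
  fst-reduct : ∀ {a b} → SN a → SN b → Red A a → ∀ {w} → fst (pair a b) ⟶ w → Red A w
  fst-reduct _        _        ra π₁                = ra
  fst-reduct (acc rs) snb      ra (fstξ (pairₗ st)) = Red-neutral A fst (fst-reduct (rs st) snb (Red-⟶ A ra st))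
  fst-reduct sna      (acc rs) ra (fstξ (pairᵣ st)) = Red-neutral A fst (fst-reduct sna (rs st) ra)
  snd-reduct : ∀ {a b} → SN a → SN b → Red B b → ∀ {w} → snd (pair a b) ⟶ w → Red B w
  snd-reduct _        _        rb π₂                = rb
  snd-reduct (acc rs) snb      rb (sndξ (pairₗ st)) = Red-neutral B snd (snd-reduct (rs st) snb rb)
  snd-reduct sna      (acc rs) rb (sndξ (pairᵣ st)) = Red-neutral B snd (snd-reduct sna (rs st) (Red-⟶ B rb st))

Red-inl : ∀ A B {a} → Red A a → Red (A ⊕ B) (inl a)
Red-inl A B ra = SN-inl (Red⇒SN A ra) , inl-reduct , inr-reduct
  where
  inl-reduct : ∀ u → inl _ ⟶* inl u → Red A u
  inl-reduct u st* with inl-⟶* st*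
  ... | _ , st*′ , refl = Red-⟶* A ra st*′
  inr-reduct : ∀ u → inl _ ⟶* inr u → Red B u
  inr-reduct u st* with inl-⟶* st*
  ... | _ , _ , ()

Red-inr : ∀ A B {b} → Red B b → Red (A ⊕ B) (inr b)
Red-inr A B rb = SN-inr (Red⇒SN B rb) , inl-reduct , inr-reduct
  where
  inl-reduct : ∀ u → inr _ ⟶* inl u → Red A u
  inl-reduct u st* with inr-⟶* st*
  ... | _ , _ , ()
  inr-reduct : ∀ u → inr _ ⟶* inr u → Red B u
  inr-reduct u st* with inr-⟶* st*
  ... | _ , st*′ , refl = Red-⟶* B rb st*′

Red-case : ∀ A B C {t b₁ b₂} → SN t → SN b₁ → SN b₂ → Red (A ⊕ B) t →
           (∀ a → Red A a → Red C (b₁ [ a ])) → (∀ a → Red B a → Red C (b₂ [ a ])) →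
           Red C (case t b₁ b₂)
Red-case A B C snt sn₁ sn₂ r H₁ H₂ = Red-neutral C case (reduct snt sn₁ sn₂ r H₁ H₂)
  where
  reduct : ∀ {t b₁ b₂} → SN t → SN b₁ → SN b₂ → Red (A ⊕ B) t →
           (∀ a → Red A a → Red C (b₁ [ a ])) → (∀ a → Red B a → Red C (b₂ [ a ])) →
           ∀ {w} → case t b₁ b₂ ⟶ w → Red C w
  reduct _ _ _ (_ , inl-red , _) H₁ _ ι₁ = H₁ _ (inl-red _ ε)
  reduct _ _ _ (_ , _ , inr-red) _ H₂ ι₂ = H₂ _ (inr-red _ ε)
  reduct (acc rs) sn₁ sn₂ r H₁ H₂ (case₀ st) = Red-case A B C (rs st) sn₁ sn₂ (Red-⟶ (A ⊕ B) r st) H₁ H₂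
  reduct snt (acc rs) sn₂ r H₁ H₂ (case₁ st) =
    Red-case A B C snt (rs st) sn₂ r (λ a ra → Red-⟶ C (H₁ a ra) (subst-⟶ _ st)) H₂
  reduct snt sn₁ (acc rs) r H₁ H₂ (case₂ st) =
    Red-case A B C snt sn₁ (rs st) r H₁ (λ a ra → Red-⟶ C (H₂ a ra) (subst-⟶ _ st))

RedSubst : List Ty → (ℕ → Tm) → Set
RedSubst Γ σ = ∀ {x A} → Γ ∋ x ∶ A → Red A (σ x)

RedSubst-++ˢ : ∀ {Γ σ n} {As : Vec Ty n} {τ : Vec Tm n} →
               Pointwise Red As τ → RedSubst Γ σ → RedSubst (toList As ++ Γ) (τ ++ˢ σ)
RedSubst-++ˢ []         red x∈       = red x∈
RedSubst-++ˢ (r ∷ _)    red vz       = r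
RedSubst-++ˢ (_ ∷ reds) red (vs x∈)  = RedSubst-++ˢ reds red x∈

Red-unboxings : ∀ {n} {As : Vec Ty n} {ts τ : Vec Tm n} →
                Pointwise (Red ∘ □_) As ts → Pointwise Unboxing ts τ → Pointwise Red As τ
Red-unboxings []              []       = []
Red-unboxings ((_ , f) ∷ reds) (w ∷ ws) = f _ w ∷ Red-unboxings reds ws

Red□⇒SN : ∀ {n} {As : Vec Ty n} {ts : Vec Tm n} → Pointwise (Red ∘ □_) As ts → All SN ts
Red□⇒SN []               = []
Red□⇒SN ((sn , _) ∷ reds) = sn ∷ Red□⇒SN reds

mutual
  fundamental : ∀ {Γ t A σ} → Γ ⊢ t ∶ A → RedSubst Γ σ → Red A (subst σ t)
  fundamental (⊢var x∈) red = red x∈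
  fundamental (⊢lam {A = A} {B} d) red s r =
    Red-β A B (SN-of-Red-instances A B (fundamental-[] d red)) (Red⇒SN A r) (fundamental-[] d red) r
  fundamental (⊢app d e) red = fundamental d red _ (fundamental e red)
  fundamental (⊢pair {A = A} {B} d e) red = Red-pair A B (fundamental d red) (fundamental e red)
  fundamental (⊢fst d) red = proj₁ (fundamental d red)
  fundamental (⊢snd d) red = proj₂ (fundamental d red)
  fundamental (⊢inl {A = A} {B} d) red = Red-inl A B (fundamental d red)
  fundamental (⊢inr {A = A} {B} d) red = Red-inr A B (fundamental d red)
  fundamental (⊢case {A = A} {B} {C} d d₁ d₂) red =
    Red-case A B C (proj₁ r) (SN-of-Red-instances A C H₁) (SN-of-Red-instances B C H₂) r H₁ H₂
    where
    r  = fundamental d red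
    H₁ = fundamental-[] d₁ red
    H₂ = fundamental-[] d₂ red
  fundamental {σ = σ} (⊢bx {n = n} {B} {s} {ts} dᵛ d) red =
    Red-box B (All-SN⇒SNᵛ (Red□⇒SN reds)) body
    where
    reds = fundamentalᵛ dᵛ red
    body : RedBody B (substᵛ σ ts) (subst (liftⁿ n σ) s)
    body {τ} ws = transport (Red B) (sym (instantiate-liftⁿ τ σ s))
                    (fundamental d (RedSubst-++ˢ (Red-unboxings reds ws) red))

  fundamental-[] : ∀ {Γ t A C σ} → (A ∷ Γ) ⊢ t ∶ C → RedSubst Γ σ →
                   ∀ a → Red A a → Red C (subst (lift σ) t [ a ])
  fundamental-[] {t = t} {C = C} {σ} d red a ra =
    transport (Red C) (sym ([]-lift σ t a)) (fundamental d (RedSubst-++ˢ (ra ∷ []) red))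

  fundamentalᵛ : ∀ {Γ n} {ts : Vec Tm n} {As σ} → Γ ⊢ᵛ ts ∶□ As → RedSubst Γ σ →
                 Pointwise (Red ∘ □_) As (substᵛ σ ts)
  fundamentalᵛ []       red = []
  fundamentalᵛ (d ∷ ds) red = fundamental d red ∷ fundamentalᵛ ds red

proposition18 : ∀ {Γ : List Ty} {t : Tm} {A : Ty} → Γ ⊢ t ∶ A → SN t
proposition18 {t = t} {A} d =
  transport SN (subst-id (λ _ → refl) t) (Red⇒SN A (fundamental d (λ {x} {B} _ → Red-var B x)))
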